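{- Let $\langle d,k,m\rangle\in M_n\setminus\{\mathbf{0}\}$. If $d=0$ then $\langle d,k,m\rangle$ is idempotent; if $d\ne 0$ then it is nilpotent, and its nilpotency index $\ell$ (the smallest $j\in\mathbb{N}$ with $\langle d,k,m\rangle^j=\mathbf{0}$) is $$\ell=1+\left\lceil\frac{m-k+1}{|d|}\right\rceil,$$ and satisfies $2\le\ell\le n$.
   Context: Fix an integer $n\ge 2$. For integers $d,k,m$ with $1-\min(0,d)\le k\le m\le n-\max(0,d)$, let $\langle d,k,m\rangle$ denote the $n\times n$ matrix with entries $x_{ij}$ ($i,j\in\{1,\dots,n\}$) equal to $1$ if $k\le i\le m$ and $j-i=d$, and $0$ otherwise (it has $m-k+1$ ones). Let $\mathbf{0}$ be the $n\times n$ zero matrix and $M_n=\{\mathbf{0}\}\cup\{\langle d,k,m\rangle: d\in\mathbb{Z},\ k,m\in\mathbb{N},\ 1-\min(0,d)\le k\le m\le n-\max(0,d)\}$, a monoid under matrix multiplication. $\lceil t\rceil$ is the ceiling of $t$. -}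

module Defs where

open import Data.Nat as ℕ using (ℕ; zero; suc; _≤?_; _/_)
open import Data.Integer as ℤ using (ℤ; +_)
open import Data.Fin as F using (Fin; toℕ)
open import Data.Bool using (Bool; true; false; if_then_else_; _∧_)
open import Relation.Nullary.Decidable using (⌊_⌋)
open import Relation.Binary.PropositionalEquality using (_≡_)
open import Data.Product using (_×_)

-- n×n matrices with natural-number entries, indexed by Fin n
-- (Fin index i stands for row/column number toℕ i + 1).
Mat : ℕ → Set
Mat n = Fin n → Fin n → ℕ

sumFin : (n : ℕ) → (Fin n → ℕ) → ℕ
sumFin zero    f = 0
sumFin (suc n) f = f F.zero ℕ.+ sumFin n (λ j → f (F.suc j))

_⊗_ : {n : ℕ} → Mat n → Mat n → Mat n
_⊗_ {n} A B i j = sumFin n (λ t → A i t ℕ.* B t j)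

idMat : (n : ℕ) → Mat n
idMat n i j = if ⌊ toℕ i ℕ.≟ toℕ j ⌋ then 1 else 0

zeroMat : (n : ℕ) → Mat n
zeroMat n i j = 0

_^ᴹ_ : {n : ℕ} → Mat n → ℕ → Mat n
_^ᴹ_ {n} A zero    = idMat n
_^ᴹ_ {n} A (suc j) = A ⊗ (A ^ᴹ j)

_≈ᴹ_ : {n : ℕ} → Mat n → Mat n → Set
A ≈ᴹ B = ∀ i j → A i j ≡ B i j

gen : (n : ℕ) → ℤ → ℕ → ℕ → Mat n
gen n d k m i j =
  if ⌊ k ≤? suc (toℕ i) ⌋ ∧ ⌊ suc (toℕ i) ≤? m ⌋
     ∧ ⌊ (+ suc (toℕ j) ℤ.- + suc (toℕ i)) ℤ.≟ d ⌋
  then 1 else 0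

ValidTriple : ℕ → ℤ → ℕ → ℕ → Set
ValidTriple n d k m =
  ((+ 1 ℤ.- (d ℤ.⊓ + 0)) ℤ.≤ + k) × (k ℕ.≤ m) × (+ m ℤ.≤ (+ n ℤ.- (d ℤ.⊔ + 0)))

-- ceiling ⌈ a / b ⌉ for b ≥ 1 (written with b = suc b'): ⌊(a + b - 1)/b⌋
ceilDiv : ℕ → ℕ → ℕ
ceilDiv a zero     = 0
ceilDiv a (suc b') = (a ℕ.+ b') / suc b'

-- Entry (i, c) of ⟨d,k,m⟩^j counts the walks i → i + d → … → i + j d = c whose first j
-- positions lie in the band [k, m].  So the j-th power is nonzero iff an arithmetic
-- progression with difference d and j terms fits into [k, m], i.e. iff (j - 1)|d| ≤ m - k.
-- With q = ⌊(m - k)/|d|⌋ = ⌈(m - k + 1)/|d|⌉ - 1 the nilpotency index is therefore q + 2,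
-- and q + 2 ≤ n because the side conditions force m - k + |d| < n.  For d = 0 the matrix
-- is diagonal with entries 0 and 1, hence idempotent.
module Submission where

open import Defs
open import Data.Nat using (ℕ; _≤_; _<_; _+_; _∸_)
open import Data.Integer using (ℤ; +_; ∣_∣)
open import Data.Product using (_×_)
open import Relation.Nullary using (¬_)
open import Relation.Binary.PropositionalEquality using (_≡_)

open import Data.Nat as ℕ using (zero; suc; z≤n; s≤s; _*_; NonZero; _≤?_)
import Data.Nat.Properties as ℕ
open import Data.Nat.DivMod using (_/_; m/n*n≤m; m*n/n≡m; /-monoˡ-≤; m/n≡1+[m∸n]/n)
open import Data.Integer as ℤ using (-[1+_]; +≤+; -_)
import Data.Integer.Properties as ℤ
open import Data.Integer.Tactic.RingSolver using (solve-∀)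
open import Data.Fin as Fin using (Fin; toℕ)
import Data.Fin.Properties as Fin
open import Data.Product using (Σ; _,_; proj₁; proj₂)
open import Data.Sum using (_⊎_; inj₁; inj₂)
open import Function using (_∘_)
open import Relation.Nullary using (yes; no; contradiction)
open import Relation.Binary.PropositionalEquality
  using (refl; sym; trans; cong; subst; _≢_; module ≡-Reasoning)

sumFin-zero : ∀ n (f : Fin n → ℕ) → (∀ t → f t ≡ 0) → sumFin n f ≡ 0
sumFin-zero zero    f f≡0 = refl
sumFin-zero (suc n) f f≡0 rewrite f≡0 Fin.zero = sumFin-zero n _ (λ t → f≡0 (Fin.suc t))

term≤sumFin : ∀ n (f : Fin n → ℕ) t → f t ≤ sumFin n f
term≤sumFin (suc n) f Fin.zero    = ℕ.m≤m+n _ _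
term≤sumFin (suc n) f (Fin.suc t) = ℕ.≤-trans (term≤sumFin n _ t) (ℕ.m≤n+m _ _)

sumFin-single : ∀ n (f : Fin n → ℕ) t → (∀ u → u ≢ t → f u ≡ 0) → sumFin n f ≡ f t
sumFin-single (suc n) f Fin.zero f≡0
  rewrite sumFin-zero n _ (λ u → f≡0 (Fin.suc u) λ ()) = ℕ.+-identityʳ _
sumFin-single (suc n) f (Fin.suc t) f≡0 rewrite f≡0 Fin.zero (λ ()) =
  sumFin-single n _ t (λ u u≢t → f≡0 (Fin.suc u) (u≢t ∘ Fin.suc-injective))

pos : {n : ℕ} → Fin n → ℤ
pos i = + suc (toℕ i)

pos-injective : {n : ℕ} {i t : Fin n} → pos i ≡ pos t → i ≡ t
pos-injective e = Fin.toℕ-injective (ℕ.suc-injective (cong ∣_∣ e))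

index-of : ∀ n {x} → + 1 ℤ.≤ x → x ℤ.≤ + n → Σ (Fin n) λ i → pos i ≡ x
index-of n {+ zero}  (+≤+ ()) _
index-of n {+ suc x} _ (+≤+ x<n) = Fin.fromℕ< x<n , cong (λ y → + suc y) (Fin.toℕ-fromℕ< x<n)

step-identity : ∀ x d j → x ℤ.+ + suc j ℤ.* d ≡ (x ℤ.+ d) ℤ.+ + j ℤ.* d
step-identity x d j = lemma x d (+ j)
  where
  lemma : ∀ x d e → x ℤ.+ (ℤ.1ℤ ℤ.+ e) ℤ.* d ≡ (x ℤ.+ d) ℤ.+ e ℤ.* d
  lemma = solve-∀

[i+j]-i≡j : ∀ i j → i ℤ.+ j ℤ.- i ≡ j
[i+j]-i≡j = solve-∀

i≡j+[i-j] : ∀ i j → i ≡ j ℤ.+ (i ℤ.- j)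
i≡j+[i-j] = solve-∀

-j+[i+j]≡i : ∀ i j → - j ℤ.+ (i ℤ.+ j) ≡ i
-j+[i+j]≡i = solve-∀

i≡[i-j]+j : ∀ i j → i ≡ (i ℤ.- j) ℤ.+ j
i≡[i-j]+j = solve-∀

[i+j]-j≡i : ∀ i j → i ℤ.+ j ℤ.- j ≡ i
[i+j]-j≡i = solve-∀

pos*neg : ∀ i j → + i ℤ.* - + j ≡ - + (i * j)
pos*neg i j = trans (sym (ℤ.neg-distribʳ-* (+ i) (+ j))) (cong -_ (sym (ℤ.pos-* i j)))

Between : ℤ → ℤ → ℤ → Set
Between a b c = (a ℤ.≤ b × b ℤ.≤ c) ⊎ (c ℤ.≤ b × b ℤ.≤ a)

step-between : ∀ x d j → Between x (x ℤ.+ d) (x ℤ.+ + suc j ℤ.* d)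
step-between x (+ a) j rewrite step-identity x (+ a) j | sym (ℤ.pos-* j a) =
  inj₁ (ℤ.i≤i+j x (+ a) , ℤ.i≤i+j _ (+ (j * a)))
step-between x -[1+ a ] j rewrite step-identity x -[1+ a ] j | pos*neg j (suc a) =
  inj₂ (ℤ.i-j≤i _ (+ (j * suc a)) , ℤ.i-j≤i x (+ suc a))

module Progression (d : ℤ) (k m : ℕ) where

  InBand : ℤ → Set
  InBand x = + k ℤ.≤ x × x ℤ.≤ + m

  band-convex : ∀ {a b c} → InBand a → InBand c → Between a b c → InBand b
  band-convex (k≤a , _) (_ , c≤m) (inj₁ (a≤b , b≤c)) = ℤ.≤-trans k≤a a≤b , ℤ.≤-trans b≤c c≤m
  band-convex (_ , a≤m) (k≤c , _) (inj₂ (c≤b , b≤a)) = ℤ.≤-trans k≤c c≤b , ℤ.≤-trans b≤a a≤m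

  infixr 5 _∷_
  data Chain : ℕ → ℤ → Set where
    []  : ∀ {x} → Chain 0 x
    _∷_ : ∀ {j x} → InBand x → Chain j (x ℤ.+ d) → Chain (suc j) x

  chain-head : ∀ {j x} → Chain (suc j) x → InBand x
  chain-head (bx ∷ _) = bx

  chain-last : ∀ {j x} → Chain (suc j) x → InBand (x ℤ.+ + j ℤ.* d)
  chain-last {x = x} (bx ∷ []) = subst InBand (sym (ℤ.+-identityʳ x)) bx
  chain-last {suc j} {x} (_ ∷ c@(_ ∷ _)) = subst InBand (sym (step-identity x d j)) (chain-last c)

  chain-prefix : ∀ {i j x} → i ≤ j → Chain j x → Chain i x
  chain-prefix z≤n       _        = []
  chain-prefix (s≤s i≤j) (bx ∷ c) = bx ∷ chain-prefix i≤j c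

  chain-between : ∀ j {x} → InBand x → InBand (x ℤ.+ + j ℤ.* d) → Chain (suc j) x
  chain-between zero    bx _  = bx ∷ []
  chain-between (suc j) {x} bx by =
    bx ∷ chain-between j (band-convex bx by (step-between x d j))
                         (subst InBand (step-identity x d j) by)

  band-span : ∀ {x e} → InBand x → InBand (x ℤ.+ e) → ∣ e ∣ + k ≤ m
  band-span {x} {e} (k≤x , x≤m) (k≤x+e , x+e≤m) = ℤ.drop‿+≤+ (span (ℤ.+∣i∣≡i⊎+∣i∣≡-i e))
    where
    open ℤ.≤-Reasoning
    span : + ∣ e ∣ ≡ e ⊎ + ∣ e ∣ ≡ - e → + ∣ e ∣ ℤ.+ + k ℤ.≤ + m
    span (inj₁ ∣e∣≡e) = begin
      + ∣ e ∣ ℤ.+ + k  ≡⟨ cong (ℤ._+ + k) ∣e∣≡e ⟩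
      e ℤ.+ + k        ≤⟨ ℤ.+-monoʳ-≤ e k≤x ⟩
      e ℤ.+ x          ≡⟨ ℤ.+-comm e x ⟩
      x ℤ.+ e          ≤⟨ x+e≤m ⟩
      + m              ∎
    span (inj₂ ∣e∣≡-e) = begin
      + ∣ e ∣ ℤ.+ + k      ≡⟨ cong (ℤ._+ + k) ∣e∣≡-e ⟩
      - e ℤ.+ + k          ≤⟨ ℤ.+-monoʳ-≤ (- e) k≤x+e ⟩
      - e ℤ.+ (x ℤ.+ e)    ≡⟨ -j+[i+j]≡i x e ⟩
      x                    ≤⟨ x≤m ⟩
      + m                  ∎

  chain-span : ∀ {j x} → Chain (suc j) x → j * ∣ d ∣ ≤ m ∸ k
  chain-span {j} c = ℕ.m+n≤o⇒m≤o∸n (j * ∣ d ∣)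
    (subst (λ s → s + k ≤ m) (ℤ.abs-* (+ j) d) (band-span (chain-head c) (chain-last c)))

chain-start : ∀ d {k m j} → k ≤ m → j * ∣ d ∣ ≤ m ∸ k →
              Σ ℤ (Progression.Chain d k m (suc j))
chain-start (+ a) {k} {m} {j} k≤m span = + k , chain-between j (ℤ.≤-refl , +≤+ k≤m) last-in-band
  where
  open Progression (+ a) k m
  k+ja≤m : k + j * a ≤ m
  k+ja≤m = subst (_≤ m) (ℕ.+-comm (j * a) k) (ℕ.m≤o∸n⇒m+n≤o (j * a) k≤m span)
  last-in-band : InBand (+ k ℤ.+ + j ℤ.* + a)
  last-in-band = subst (λ e → InBand (+ k ℤ.+ e)) (ℤ.pos-* j a)
                   (+≤+ (ℕ.m≤m+n k (j * a)) , +≤+ k+ja≤m)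
chain-start -[1+ a ] {k} {m} {j} k≤m span = + m , chain-between j (+≤+ k≤m , ℤ.≤-refl) last-in-band
  where
  open Progression -[1+ a ] k m
  ja+k≤m : j * suc a + k ≤ m
  ja+k≤m = ℕ.m≤o∸n⇒m+n≤o (j * suc a) k≤m span
  k≤m-ja : + k ℤ.≤ + m ℤ.- + (j * suc a)
  k≤m-ja rewrite ℤ.m-n≡m⊖n m (j * suc a) | ℤ.⊖-≥ (ℕ.m+n≤o⇒m≤o (j * suc a) ja+k≤m) =
    +≤+ (ℕ.m+n≤o⇒m≤o∸n k (subst (_≤ m) (ℕ.+-comm (j * suc a) k) ja+k≤m))
  last-in-band : InBand (+ m ℤ.+ + j ℤ.* -[1+ a ])
  last-in-band = subst (λ e → InBand (+ m ℤ.+ e)) (sym (pos*neg j (suc a)))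
                   (k≤m-ja , ℤ.i-j≤i (+ m) (+ (j * suc a)))

idMat-diagonal : ∀ n (i : Fin n) → idMat n i i ≡ 1
idMat-diagonal n i with toℕ i ℕ.≟ toℕ i
... | yes _   = refl
... | no i≢i = contradiction refl i≢i

module Powers (n : ℕ) (d : ℤ) (k m : ℕ) where
  open Progression d k m

  A : Mat n
  A = gen n d k m

  Edge : Fin n → Fin n → Set
  Edge i t = InBand (pos i) × pos t ≡ pos i ℤ.+ d

  gen-edge : ∀ {i t} → Edge i t → A i t ≡ 1
  gen-edge {i} {t} ((+≤+ k≤i , +≤+ i≤m) , t≡i+d)
    with k ≤? suc (toℕ i) | suc (toℕ i) ≤? m | pos t ℤ.- pos i ℤ.≟ d
  ... | yes _   | yes _   | yes _     = refl
  ... | no k≰i  | _       | _         = contradiction k≤i k≰i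
  ... | yes _   | no i≰m  | _         = contradiction i≤m i≰m
  ... | yes _   | yes _   | no t-i≢d  =
    contradiction (trans (cong (ℤ._- pos i) t≡i+d) ([i+j]-i≡j (pos i) d)) t-i≢d

  gen-edge-or-zero : ∀ i t → Edge i t ⊎ A i t ≡ 0
  gen-edge-or-zero i t with k ≤? suc (toℕ i) | suc (toℕ i) ≤? m | pos t ℤ.- pos i ℤ.≟ d
  ... | yes k≤i | yes i≤m | yes t-i≡d =
    inj₁ ((+≤+ k≤i , +≤+ i≤m) ,
          trans (i≡j+[i-j] (pos t) (pos i)) (cong (λ e → pos i ℤ.+ e) t-i≡d))
  ... | no _    | _       | _         = inj₂ refl
  ... | yes _   | no _    | _         = inj₂ refl
  ... | yes _   | yes _   | no _      = inj₂ refl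

  power-vanishes-off-chains : ∀ j i c → ¬ Chain j (pos i) → (A ^ᴹ j) i c ≡ 0
  power-vanishes-off-chains zero    i c no-chain = contradiction [] no-chain
  power-vanishes-off-chains (suc j) i c no-chain = sumFin-zero n _ term≡0
    where
    term≡0 : ∀ t → A i t * (A ^ᴹ j) t c ≡ 0
    term≡0 t with gen-edge-or-zero i t
    ... | inj₂ Ait≡0 rewrite Ait≡0 = refl
    ... | inj₁ (in-band , t≡i+d) =
      trans (cong (A i t *_) (power-vanishes-off-chains j t c no-chain-from-t)) (ℕ.*-zeroʳ (A i t))
      where
      no-chain-from-t : ¬ Chain j (pos t)
      no-chain-from-t chain = no-chain (in-band ∷ subst (Chain j) t≡i+d chain)

  power-nonzero-on-chains : (∀ {x} → InBand x → Σ (Fin n) λ t → pos t ≡ x ℤ.+ d) →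
                            ∀ j i → Chain j (pos i) → Σ (Fin n) λ c → (A ^ᴹ j) i c ≢ 0
  power-nonzero-on-chains step zero    i [] =
    i , λ eq → ℕ.1+n≢0 (trans (sym (idMat-diagonal n i)) eq)
  power-nonzero-on-chains step (suc j) i (in-band ∷ chain) with step in-band
  ... | t , t≡i+d with power-nonzero-on-chains step j t (subst (Chain j) (sym t≡i+d) chain)
  ...   | c , nonzero = c , λ eq → nonzero (ℕ.n≤0⇒n≡0 (subst ((A ^ᴹ j) t c ≤_) eq term≤entry))
    where
    term≤entry : (A ^ᴹ j) t c ≤ (A ^ᴹ suc j) i c
    term≤entry = subst (_≤ (A ^ᴹ suc j) i c)
                   (trans (cong (_* (A ^ᴹ j) t c) (gen-edge (in-band , t≡i+d))) (ℕ.*-identityˡ _))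
                   (term≤sumFin n _ t)

gen-idempotent : ∀ n k m → (gen n (+ 0) k m ⊗ gen n (+ 0) k m) ≈ᴹ gen n (+ 0) k m
gen-idempotent n k m i c = trans (sumFin-single n _ i off-diagonal) diagonal-factor
  where
  open Powers n (+ 0) k m
  edge-diagonal : ∀ {t} → Edge i t → t ≡ i
  edge-diagonal (_ , t≡i+0) = pos-injective (trans t≡i+0 (ℤ.+-identityʳ (pos i)))
  off-diagonal : ∀ u → u ≢ i → A i u * A u c ≡ 0
  off-diagonal u u≢i with gen-edge-or-zero i u
  ... | inj₁ edge = contradiction (edge-diagonal edge) u≢i
  ... | inj₂ Aiu≡0 rewrite Aiu≡0 = refl
  diagonal-factor : A i i * A i c ≡ A i c
  diagonal-factor with gen-edge-or-zero i c
  ... | inj₁ (in-band , _) rewrite gen-edge {i} {i} (in-band , sym (ℤ.+-identityʳ (pos i))) =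
    ℕ.*-identityˡ _
  ... | inj₂ Aic≡0 rewrite Aic≡0 = ℕ.*-zeroʳ (A i i)

module Validity (n : ℕ) (d : ℤ) (k m : ℕ) (valid : ValidTriple n d k m) where
  open Progression d k m

  k≤m : k ≤ m
  k≤m = proj₁ (proj₂ valid)

  1≤k : + 1 ℤ.≤ + k
  1≤k = ℤ.≤-trans (ℤ.+-monoʳ-≤ (+ 1) (ℤ.neg-mono-≤ (ℤ.i⊓j≤j d (+ 0)))) (proj₁ valid)

  m≤n : + m ℤ.≤ + n
  m≤n = ℤ.≤-trans (proj₂ (proj₂ valid))
          (subst (λ e → + n ℤ.- (d ℤ.⊔ + 0) ℤ.≤ e) (ℤ.+-identityʳ (+ n))
            (ℤ.+-monoʳ-≤ (+ n) (ℤ.neg-mono-≤ (ℤ.i≤j⊔i d (+ 0)))))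

  step-inside : ∀ {x} → InBand x → + 1 ℤ.≤ x ℤ.+ d × x ℤ.+ d ℤ.≤ + n
  step-inside {x} (k≤x , x≤m) = lower , upper
    where
    open ℤ.≤-Reasoning
    lower : + 1 ℤ.≤ x ℤ.+ d
    lower = begin
      + 1                                    ≡⟨ i≡[i-j]+j (+ 1) (d ℤ.⊓ + 0) ⟩
      (+ 1 ℤ.- (d ℤ.⊓ + 0)) ℤ.+ (d ℤ.⊓ + 0)  ≤⟨ ℤ.+-mono-≤ (proj₁ valid) (ℤ.i⊓j≤i d (+ 0)) ⟩
      + k ℤ.+ d                              ≤⟨ ℤ.+-monoˡ-≤ d k≤x ⟩
      x ℤ.+ d                                ∎
    upper : x ℤ.+ d ℤ.≤ + n
    upper = begin
      x ℤ.+ d                                ≤⟨ ℤ.+-monoˡ-≤ d (ℤ.≤-trans x≤m (proj₂ (proj₂ valid))) ⟩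
      (+ n ℤ.- (d ℤ.⊔ + 0)) ℤ.+ d            ≤⟨ ℤ.+-monoʳ-≤ (+ n ℤ.- (d ℤ.⊔ + 0)) (ℤ.i≤i⊔j d (+ 0)) ⟩
      (+ n ℤ.- (d ℤ.⊔ + 0)) ℤ.+ (d ℤ.⊔ + 0)  ≡⟨ i≡[i-j]+j (+ n) (d ℤ.⊔ + 0) ⟨
      + n                                    ∎

  band-index : ∀ {x} → InBand x → Σ (Fin n) λ i → pos i ≡ x
  band-index (k≤x , x≤m) = index-of n (ℤ.≤-trans 1≤k k≤x) (ℤ.≤-trans x≤m m≤n)

  step-index : ∀ {x} → InBand x → Σ (Fin n) λ t → pos t ≡ x ℤ.+ d
  step-index in-band = index-of n (proj₁ (step-inside in-band)) (proj₂ (step-inside in-band))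

  m+∣d∣≤n : + ∣ d ∣ ≡ d → m + ∣ d ∣ ≤ n
  m+∣d∣≤n ∣d∣≡d = ℤ.drop‿+≤+ (subst (λ e → + m ℤ.+ e ℤ.≤ + n) (sym ∣d∣≡d)
                    (proj₂ (step-inside (+≤+ k≤m , ℤ.≤-refl))))

  ∣d∣<k : + ∣ d ∣ ≡ - d → ∣ d ∣ < k
  ∣d∣<k ∣d∣≡-d = ℤ.drop‿+≤+ (begin
    + 1 ℤ.+ + ∣ d ∣          ≤⟨ ℤ.+-monoˡ-≤ (+ ∣ d ∣) (proj₁ (step-inside (ℤ.≤-refl , +≤+ k≤m))) ⟩
    (+ k ℤ.+ d) ℤ.+ + ∣ d ∣  ≡⟨ cong (λ e → (+ k ℤ.+ d) ℤ.+ e) ∣d∣≡-d ⟩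
    (+ k ℤ.+ d) ℤ.- d        ≡⟨ [i+j]-j≡i (+ k) d ⟩
    + k                      ∎)
    where open ℤ.≤-Reasoning

  span<n : m ∸ k + ∣ d ∣ < n
  span<n with ℤ.+∣i∣≡i⊎+∣i∣≡-i d
  ... | inj₁ ∣d∣≡d = begin-strict
      m ∸ k + ∣ d ∣  <⟨ ℕ.+-monoˡ-< ∣ d ∣ (ℕ.∸-monoʳ-< (ℤ.drop‿+≤+ 1≤k) k≤m) ⟩
      m + ∣ d ∣      ≤⟨ m+∣d∣≤n ∣d∣≡d ⟩
      n              ∎
    where open ℕ.≤-Reasoning
  ... | inj₂ ∣d∣≡-d = begin-strict
      m ∸ k + ∣ d ∣  <⟨ ℕ.+-monoʳ-< (m ∸ k) (∣d∣<k ∣d∣≡-d) ⟩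
      m ∸ k + k      ≡⟨ ℕ.m∸n+n≡m k≤m ⟩
      m              ≤⟨ ℤ.drop‿+≤+ m≤n ⟩
      n              ∎
    where open ℕ.≤-Reasoning

m*n≤o⇒m≤o/n : ∀ {j x D} .{{_ : NonZero D}} → j * D ≤ x → j ≤ x / D
m*n≤o⇒m≤o/n {j} {x} {D} j*D≤x = subst (_≤ x / D) (m*n/n≡m j D) (/-monoˡ-≤ D j*D≤x)

ceilDiv-suc : ∀ r D .{{_ : NonZero D}} → ceilDiv (suc r) D ≡ suc (r / D)
ceilDiv-suc r (suc a) = begin
  (suc r + a) / suc a                  ≡⟨ cong (_/ suc a) (sym (ℕ.+-suc r a)) ⟩
  (r + suc a) / suc a                  ≡⟨ m/n≡1+[m∸n]/n (ℕ.m≤n+m (suc a) r) ⟩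
  suc ((r + suc a ∸ suc a) / suc a)    ≡⟨ cong (λ x → suc (x / suc a)) (ℕ.m+n∸n≡m r (suc a)) ⟩
  suc (r / suc a)                      ∎
  where open ≡-Reasoning

module Nilpotency (n : ℕ) (d : ℤ) (k m : ℕ) (valid : ValidTriple n d k m)
                  .{{_ : NonZero ∣ d ∣}} where
  open Progression d k m
  open Powers n d k m
  open Validity n d k m valid

  q : ℕ
  q = (m ∸ k) / ∣ d ∣

  no-chain-of-length-2+q : ∀ {x} → ¬ Chain (2 + q) x
  no-chain-of-length-2+q chain = ℕ.1+n≰n (m*n≤o⇒m≤o/n (chain-span chain))

  power-vanishes : (A ^ᴹ (2 + q)) ≈ᴹ zeroMat n
  power-vanishes i c = power-vanishes-off-chains (2 + q) i c no-chain-of-length-2+q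

  power-nonvanishing : ∀ {j} → j ≤ suc q → ¬ ((A ^ᴹ j) ≈ᴹ zeroMat n)
  power-nonvanishing {j} j≤1+q A^j≈0 with chain-start d k≤m (m/n*n≤m (m ∸ k) ∣ d ∣)
  ... | x , chain with band-index (chain-head chain)
  ...   | i , i≡x with power-nonzero-on-chains step-index j i
                         (chain-prefix j≤1+q (subst (Chain (suc q)) (sym i≡x) chain))
  ...     | c , nonzero = nonzero (A^j≈0 i c)

  2+q≤n : 2 + q ≤ n
  2+q≤n = begin
    2 + q                    ≤⟨ s≤s (ℕ.m≤m*n (suc q) ∣ d ∣) ⟩
    suc (∣ d ∣ + q * ∣ d ∣)   ≡⟨ cong suc (ℕ.+-comm ∣ d ∣ (q * ∣ d ∣)) ⟩
    suc (q * ∣ d ∣ + ∣ d ∣)   ≤⟨ s≤s (ℕ.+-monoˡ-≤ ∣ d ∣ (m/n*n≤m (m ∸ k) ∣ d ∣)) ⟩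
    suc (m ∸ k + ∣ d ∣)      ≤⟨ span<n ⟩
    n                        ∎
    where open ℕ.≤-Reasoning

  ceilDiv≡1+q : ceilDiv (m + 1 ∸ k) ∣ d ∣ ≡ suc q
  ceilDiv≡1+q = trans (cong (λ r → ceilDiv r ∣ d ∣) m+1∸k≡1+[m∸k]) (ceilDiv-suc (m ∸ k) ∣ d ∣)
    where
    m+1∸k≡1+[m∸k] : m + 1 ∸ k ≡ suc (m ∸ k)
    m+1∸k≡1+[m∸k] = trans (ℕ.+-∸-comm 1 k≤m) (ℕ.+-comm (m ∸ k) 1)

  nilpotency-index : let ℓ = 1 + ceilDiv (m + 1 ∸ k) ∣ d ∣ in
    ((A ^ᴹ ℓ) ≈ᴹ zeroMat n) × (∀ j → j < ℓ → ¬ ((A ^ᴹ j) ≈ᴹ zeroMat n)) × (2 ≤ ℓ) × (ℓ ≤ n)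
  nilpotency-index rewrite ceilDiv≡1+q =
    power-vanishes , (λ j j<2+q → power-nonvanishing (ℕ.≤-pred j<2+q)) , s≤s (s≤s z≤n) , 2+q≤n

theorem4 : (n : ℕ) → 2 ≤ n → (d : ℤ) → (k m : ℕ) → ValidTriple n d k m →
    (d ≡ + 0 → (gen n d k m ⊗ gen n d k m) ≈ᴹ gen n d k m)
    × (¬ d ≡ + 0 →
        ((gen n d k m ^ᴹ (1 + ceilDiv (m + 1 ∸ k) ∣ d ∣)) ≈ᴹ zeroMat n)
        × (∀ j → j < 1 + ceilDiv (m + 1 ∸ k) ∣ d ∣ → ¬ ((gen n d k m ^ᴹ j) ≈ᴹ zeroMat n))
        × (2 ≤ 1 + ceilDiv (m + 1 ∸ k) ∣ d ∣)
        × (1 + ceilDiv (m + 1 ∸ k) ∣ d ∣ ≤ n))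
theorem4 n _ d k m valid =
  (λ { refl → gen-idempotent n k m }) ,
  (λ d≢0 → Nilpotency.nilpotency-index n d k m valid {{ℕ.≢-nonZero (d≢0 ∘ ℤ.∣i∣≡0⇒i≡0)}})
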